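{- Let $\mathcal A=(W_{\mathcal A},\preccurlyeq_{\mathcal A},\lambda_{\mathcal A})$ and $\mathcal B=(W_{\mathcal B},\preccurlyeq_{\mathcal B},\lambda_{\mathcal B})$ be labeled posets. If a simulation $\sigma\subseteq W_{\mathcal A}\times W_{\mathcal B}$ from $\mathcal A$ to $\mathcal B$ exists, $(W_{\mathcal A},\preccurlyeq_{\mathcal A})$ is a finite tree, and $w\mathrel\sigma w'$, then there is an immersion $\sigma'\subseteq W_{\mathcal A}\times W_{\mathcal B}$ from $\mathcal A$ to $\mathcal B$ such that $w\in\mathrm{dom}(\sigma')$.
   Context: A labeled poset is a triple $(W,\preccurlyeq,\lambda)$ where $(W,\preccurlyeq)$ is a poset and $\lambda\colon W\to\Lambda$ is a function into a set $\Lambda$ of labels. A relation $\sigma\subseteq W_{\mathcal A}\times W_{\mathcal B}$ is a simulation from $\mathcal A$ to $\mathcal B$ if $\mathrm{dom}(\sigma)=\{w\mid\exists v\,(w,v)\in\sigma\}=W_{\mathcal A}$ and whenever $w\mathrel\sigma v$: $\lambda_{\mathcal A}(w)=\lambda_{\mathcal B}(v)$, and for every $w'$ with $w\preccurlyeq_{\mathcal A}w'$ there is $v'$ with $v\preccurlyeq_{\mathcal B}v'$ and $w'\mathrel\sigma v'$. An immersion is a simulation that is a function. A poset $(U,\le)$ is a tree if there is a relation $\lhd$ on $U$ whose reflexive transitive closure is $\le$ and an element $r$ (the root) such that for every $u\in U$ there is a unique finite sequence $r=v_0\lhd v_1\lhd\dots\lhd v_n=u$. -}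

module Defs where

open import Level using (0ℓ)
open import Data.Nat using (ℕ)
open import Data.Fin using (Fin)
open import Data.List using (List; []; _∷_)
open import Data.Product using (Σ; ∃; _×_; _,_)
open import Function.Bundles using (_↔_; _⇔_)
open import Relation.Binary.Core using (Rel; REL)
open import Relation.Binary.Structures using (IsPartialOrder)
open import Relation.Binary.PropositionalEquality using (_≡_)

record LabeledPoset (Λ : Set) : Set₁ where
  field
    W         : Set
    _≼_       : Rel W 0ℓ
    isPartial : IsPartialOrder _≡_ _≼_
    label     : W → Λ

open LabeledPoset public

record IsSimulation {Λ : Set} (A B : LabeledPoset Λ) (σ : REL (W A) (W B) 0ℓ) : Set where
  field
    total  : (w : W A) → ∃ λ v → σ w v
    labels : ∀ {w v} → σ w v → label A w ≡ label B v
    forth  : ∀ {w v} → σ w v → ∀ w' → _≼_ A w w' →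
             ∃ λ v' → _≼_ B v v' × σ w' v'

-- An immersion is a simulation that is a function; we represent it by a
-- function f : W_A → W_B whose graph is a simulation.
Graph : {X Y : Set} → (X → Y) → REL X Y 0ℓ
Graph f x y = f x ≡ y

IsImmersion : {Λ : Set} (A B : LabeledPoset Λ) → (W A → W B) → Set
IsImmersion A B f = IsSimulation A B (Graph f)

data Chain {U : Set} (_◁_ : Rel U 0ℓ) : U → U → Set where
  done : ∀ {x} → Chain _◁_ x x
  step : ∀ {x y z} → x ◁ y → Chain _◁_ y z → Chain _◁_ x z

vertices : {U : Set} {_◁_ : Rel U 0ℓ} {x y : U} → Chain _◁_ x y → List U
vertices {x = x} done         = x ∷ []
vertices {x = x} (step _ c)   = x ∷ vertices c

IsTree : (U : Set) → Rel U 0ℓ → Set₁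
IsTree U _≤_ =
  Σ (Rel U 0ℓ) λ _◁_ →
    ((x y : U) → (x ≤ y) ⇔ Chain _◁_ x y) ×
    Σ U λ r → (u : U) → Σ (Chain _◁_ r u) λ p →
      (q : Chain _◁_ r u) → vertices q ≡ vertices p

IsFinite : Set → Set
IsFinite U = Σ ℕ λ n → Fin n ↔ U

IsFiniteTree : (U : Set) → Rel U 0ℓ → Set₁
IsFiniteTree U _≤_ = IsFinite U × IsTree U _≤_

module Submission where

-- We define an immersion f : W_A → W_B by recursion on depth:
-- the root goes to any σ-partner, and a child u of a node a goes to a
-- σ-partner of u lying above f a, which exists by the forth condition of σ
-- applied to the pair (a, f a) and the step a ◁ u.  Then f respects labels
-- (every f u is a σ-partner of u) and f is monotone along ◁, hence along
-- every chain, hence along ≼_A; this gives the forth condition of its graph.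

open import Defs
open import Level using (0ℓ)
open import Data.Nat using (ℕ; zero; suc; _+_)
open import Data.Nat.Properties using (+-comm)
open import Data.List using ([]; _∷_; _∷ʳ_; length)
open import Data.List.Properties using (length-++; ∷ʳ-injectiveˡ; ∷ʳ-injectiveʳ)
open import Data.Product using (Σ; ∃; _×_; _,_; proj₁; proj₂)
open import Data.Empty using (⊥)
open import Function.Bundles using (Equivalence; _⇔_)
open import Relation.Binary.Core using (Rel; REL)
open import Relation.Binary.Definitions using (Reflexive; Transitive)
open import Relation.Binary.Structures using (IsPartialOrder)
open import Relation.Binary.PropositionalEquality
  using (_≡_; refl; sym; trans; cong; subst; module ≡-Reasoning)

module Chains {U : Set} (_◁_ : Rel U 0ℓ) where

  _▷_ : ∀ {x y z} → Chain _◁_ x y → y ◁ z → Chain _◁_ x z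
  done       ▷ h = step h done
  step h′ c ▷ h = step h′ (c ▷ h)

  vertices-▷ : ∀ {x y z} (c : Chain _◁_ x y) (h : y ◁ z) →
               vertices (c ▷ h) ≡ vertices c ∷ʳ z
  vertices-▷ done         h = refl
  vertices-▷ (step h′ c) h = cong (_ ∷_) (vertices-▷ c h)

  vertices-nonempty : ∀ {x y} (c : Chain _◁_ x y) → vertices c ≡ [] → ⊥
  vertices-nonempty done       ()
  vertices-nonempty (step _ _) ()

  vertices-end : ∀ {x y} (c : Chain _◁_ x y) → ∃ λ l → vertices c ≡ l ∷ʳ y
  vertices-end done        = [] , refl
  vertices-end (step _ c) = let l , e = vertices-end c in _ ∷ l , cong (_ ∷_) e

  same-vertices⇒same-end : ∀ {x a b} (c : Chain _◁_ x a) (d : Chain _◁_ x b) →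
                           vertices c ≡ vertices d → a ≡ b
  same-vertices⇒same-end c d e =
    let l , ec = vertices-end c ; m , ed = vertices-end d
    in ∷ʳ-injectiveʳ l m (trans (sym ec) (trans e ed))

  data LastStep {x z : U} (c : Chain _◁_ x z) : Set where
    noStep   : x ≡ z → vertices c ≡ x ∷ [] → LastStep c
    lastStep : (a : U) (c′ : Chain _◁_ x a) → a ◁ z →
               vertices c ≡ vertices c′ ∷ʳ z → LastStep c

  lastStep? : ∀ {x z} (c : Chain _◁_ x z) → LastStep c
  lastStep? done = noStep refl refl
  lastStep? (step h c) with lastStep? c
  ... | noStep refl e      = lastStep _ done h (cong (_ ∷_) e)
  ... | lastStep a c′ h′ e = lastStep a (step h c′) h′ (cong (_ ∷_) e)

  chain-monotone : {V : Set} {_≤_ : Rel V 0ℓ} → Reflexive _≤_ → Transitive _≤_ →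
                   (f : U → V) → (∀ {x y} → x ◁ y → f x ≤ f y) →
                   ∀ {x y} → Chain _◁_ x y → f x ≤ f y
  chain-monotone              ≤-refl ≤-trans f mono done       = ≤-refl
  chain-monotone {_≤_ = _≤_} ≤-refl ≤-trans f mono (step h c) =
    ≤-trans (mono h) (chain-monotone {_≤_ = _≤_} ≤-refl ≤-trans f mono c)

module RootedTree {U : Set} (_◁_ : Rel U 0ℓ) (r : U)
    (canonical : (u : U) → Σ (Chain _◁_ r u) λ p →
                   (q : Chain _◁_ r u) → vertices q ≡ vertices p) where
  open Chains _◁_

  path : (u : U) → Chain _◁_ r u
  path u = proj₁ (canonical u)

  path-unique : (u : U) (q : Chain _◁_ r u) → vertices q ≡ vertices (path u)
  path-unique u = proj₂ (canonical u)

  depth : U → ℕ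
  depth u = length (vertices (path u))

  data Parent (u : U) : Set where
    root    : Parent u
    childOf : (a : U) → a ◁ u → depth u ≡ suc (depth a) → Parent u

  parent : (u : U) → Parent u
  parent u with lastStep? (path u)
  ... | noStep _ _          = root
  ... | lastStep a c′ h e = childOf a h (begin
      length (vertices (path u))      ≡⟨ cong length e ⟩
      length (vertices c′ ∷ʳ u)       ≡⟨ length-++ (vertices c′) ⟩
      length (vertices c′) + 1        ≡⟨ +-comm (length (vertices c′)) 1 ⟩
      suc (length (vertices c′))      ≡⟨ cong (λ l → suc (length l)) (path-unique a c′) ⟩
      suc (depth a)                   ∎)
    where open ≡-Reasoning

  ParentIs : U → {y : U} → Parent y → Set
  ParentIs x root            = ⊥
  ParentIs x (childOf a _ _) = a ≡ x

  parent-of-child : ∀ {x y} → x ◁ y → ParentIs x (parent y)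
  parent-of-child {x} {y} h with lastStep? (path y)
  ... | noStep _ e =
    vertices-nonempty (path x) (∷ʳ-injectiveˡ (vertices (path x)) [] (begin
      vertices (path x) ∷ʳ y          ≡⟨ sym (vertices-▷ (path x) h) ⟩
      vertices (path x ▷ h)           ≡⟨ path-unique y (path x ▷ h) ⟩
      vertices (path y)               ≡⟨ e ⟩
      r ∷ []                          ∎))
    where open ≡-Reasoning
  ... | lastStep a c′ _ e =
    same-vertices⇒same-end c′ (path x) (∷ʳ-injectiveˡ (vertices c′) (vertices (path x)) (begin
      vertices c′ ∷ʳ y                ≡⟨ sym e ⟩
      vertices (path y)               ≡⟨ sym (path-unique y (path x ▷ h)) ⟩
      vertices (path x ▷ h)           ≡⟨ vertices-▷ (path x) h ⟩
      vertices (path x) ∷ʳ y          ∎))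
    where open ≡-Reasoning

module ImmersionFromSimulation {Λ : Set} (A B : LabeledPoset Λ)
    (σ : REL (W A) (W B) 0ℓ) (sim : IsSimulation A B σ)
    (tree : IsTree (W A) (_≼_ A)) where
  open IsSimulation sim
  open IsPartialOrder (isPartial B) using () renaming (refl to ≼B-refl; trans to ≼B-trans)

  _◁_ : Rel (W A) 0ℓ
  _◁_ = proj₁ tree

  ≼⇔chain : (x y : W A) → _≼_ A x y ⇔ Chain _◁_ x y
  ≼⇔chain = proj₁ (proj₂ tree)

  open Chains _◁_
  open RootedTree _◁_ (proj₁ (proj₂ (proj₂ tree))) (proj₂ (proj₂ (proj₂ tree)))

  ◁⇒≼ : ∀ {a u} → a ◁ u → _≼_ A a u
  ◁⇒≼ {a} {u} h = Equivalence.from (≼⇔chain a u) (step h done)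

  climb : ∀ {a u v} → σ a v → a ◁ u → ∃ λ v′ → _≼_ B v v′ × σ u v′
  climb {u = u} s h = forth s u (◁⇒≼ h)

  -- A σ-partner for every node, computed with fuel n = depth u: the root
  -- takes any partner, a child one obtained by climbing from its parent.
  partner : ℕ → (u : W A) → Σ (W B) (σ u)
  partnerBelow : ℕ → (u : W A) → Parent u → Σ (W B) (σ u)
  partner zero    u = total u
  partner (suc n) u = partnerBelow n u (parent u)
  partnerBelow n u root            = total u
  partnerBelow n u (childOf a h _) =
    let c = climb (proj₂ (partner n a)) h in proj₁ c , proj₂ (proj₂ c)

  f : W A → W B
  f u = proj₁ (partner (depth u) u)

  f-child : ∀ {a u} (h : a ◁ u) (d : depth u ≡ suc (depth a)) →
            parent u ≡ childOf a h d → _≼_ B (f a) (f u)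
  f-child {a} {u} h d eq = subst (_≼_ B (f a)) (sym f-u) (proj₁ (proj₂ climbed))
    where
      climbed : ∃ λ v′ → _≼_ B (f a) v′ × σ u v′
      climbed = climb (proj₂ (partner (depth a) a)) h
      f-u : f u ≡ proj₁ climbed
      f-u = begin
        proj₁ (partner (depth u) u)                  ≡⟨ cong (λ n → proj₁ (partner n u)) d ⟩
        proj₁ (partnerBelow (depth a) u (parent u))  ≡⟨ cong (λ p → proj₁ (partnerBelow (depth a) u p)) eq ⟩
        proj₁ climbed                                ∎
        where open ≡-Reasoning

  -- Hence f is monotone along covering steps: a target's parent is the source.
  f-◁ : ∀ {x y} → x ◁ y → _≼_ B (f x) (f y)
  f-◁ {y = y} hxy with parent y in eq | parent-of-child hxy
  ... | childOf _ h d | refl = f-child h d eq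

  f-monotone : ∀ {x y} → _≼_ A x y → _≼_ B (f x) (f y)
  f-monotone {x} {y} le =
    chain-monotone {_≤_ = _≼_ B} ≼B-refl ≼B-trans f f-◁ (Equivalence.to (≼⇔chain x y) le)

  immersion : IsImmersion A B f
  immersion = record
    { total  = λ u → f u , refl
    ; labels = λ { {u} refl → labels (proj₂ (partner (depth u) u)) }
    ; forth  = λ { refl u′ le → f u′ , f-monotone le , refl }
    }

lemma18 : {Λ : Set} (A B : LabeledPoset Λ) (σ : REL (W A) (W B) 0ℓ) →
          IsSimulation A B σ → IsFiniteTree (W A) (_≼_ A) →
          (w : W A) (w' : W B) → σ w w' →
          Σ (W A → W B) λ σ' → IsImmersion A B σ' × (∃ λ v → Graph σ' w v)
lemma18 A B σ sim (_ , tree) w _ _ = f , immersion , f w , refl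
  where open ImmersionFromSimulation A B σ sim tree
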